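{- If $G$ is a threshold graph, then $\chi(G)=\Sigma(G)=\Psi(G)$.
   Context: All graphs are finite and simple; $\chi$ is the chromatic number. A threshold graph is a graph with no induced $2K_2$, $C_4$ or $P_4$. A simple fold of a graph with respect to two vertices $x,y$ at distance exactly two is the operation identifying $x$ and $y$. A folding is a homomorphism that is a composition of a sequence of simple folds. The folding number $\Sigma(G)$ of a connected graph $G$ is the largest $s$ such that $G$ folds onto the complete graph $K_s$; for disconnected $G$ it is the maximum folding number over its components. The achromatic number $\Psi(G)$ is the largest number of colors in a proper vertex coloring of $G$ such that for every two colors there exist two adjacent vertices having those two colors. -}

module Defs where

open import Data.Nat using (ℕ; zero; suc; _≤_; _≡ᵇ_)
open import Data.Fin using (Fin; toℕ)
open import Data.Bool using (Bool; true; false; _∧_; _∨_)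
open import Data.List using (List; _∷_; [])
open import Data.Bool.ListAction using (any)
open import Data.Product using (Σ; ∃; _×_; _,_)
open import Data.Sum using (_⊎_)
open import Relation.Nullary using (¬_)
open import Relation.Binary.PropositionalEquality using (_≡_; _≢_)
open import Function.Definitions using (Injective; Surjective)

record Graph (n : ℕ) : Set where
  field
    Adj    : Fin n → Fin n → Bool
    sym    : ∀ i j → Adj i j ≡ Adj j i
    irrefl : ∀ i → Adj i i ≡ false
open Graph public

_~[_]_ : ∀ {n} → Fin n → Graph n → Fin n → Set
i ~[ G ] j = Adj G i j ≡ true

fromEdges : List (ℕ × ℕ) → Fin 4 → Fin 4 → Bool
fromEdges es i j =
  any (λ { (a , b) → ((toℕ i ≡ᵇ a) ∧ (toℕ j ≡ᵇ b)) ∨ ((toℕ i ≡ᵇ b) ∧ (toℕ j ≡ᵇ a)) }) es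

2K₂ C₄ P₄ : Fin 4 → Fin 4 → Bool
2K₂ = fromEdges ((0 , 1) ∷ (2 , 3) ∷ [])
C₄  = fromEdges ((0 , 1) ∷ (1 , 2) ∷ (2 , 3) ∷ (3 , 0) ∷ [])
P₄  = fromEdges ((0 , 1) ∷ (1 , 2) ∷ (2 , 3) ∷ [])

HasInduced : ∀ {n} → Graph n → (Fin 4 → Fin 4 → Bool) → Set
HasInduced {n} G H =
  Σ (Fin 4 → Fin n) λ f → Injective _≡_ _≡_ f ×
    (∀ i j → i ≢ j → Adj G (f i) (f j) ≡ H i j)

Threshold : ∀ {n} → Graph n → Set
Threshold G = ¬ HasInduced G 2K₂ × ¬ HasInduced G C₄ × ¬ HasInduced G P₄

ProperColoring : ∀ {n} → Graph n → (k : ℕ) → (Fin n → Fin k) → Set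
ProperColoring G k c = ∀ i j → i ~[ G ] j → c i ≢ c j

IsChromaticNumber : ∀ {n} → Graph n → ℕ → Set
IsChromaticNumber G k =
  (Σ _ λ c → ProperColoring G k c) ×
  (∀ m (c : _) → ProperColoring G m c → k ≤ m)

CompleteColoring : ∀ {n} → Graph n → (k : ℕ) → (Fin n → Fin k) → Set
CompleteColoring G k c =
  ProperColoring G k c × Surjective _≡_ _≡_ c ×
  (∀ (α β : Fin k) → α ≢ β →
     ∃ λ i → ∃ λ j → i ~[ G ] j × c i ≡ α × c j ≡ β)

IsAchromaticNumber : ∀ {n} → Graph n → ℕ → Set
IsAchromaticNumber G k =
  (Σ _ λ c → CompleteColoring G k c) ×
  (∀ m (c : _) → CompleteColoring G m c → m ≤ k)

Dist2 : ∀ {n} → Graph n → Fin n → Fin n → Set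
Dist2 G x y = x ≢ y × Adj G x y ≡ false × ∃ λ z → x ~[ G ] z × z ~[ G ] y

-- H is (a labelled copy of) the graph obtained from G by identifying x, y
-- at distance two: q is the quotient map, identifying exactly x and y.
SimpleFold : ∀ {n} → Graph (suc n) → Graph n → Set
SimpleFold {n} G H =
  Σ (Fin (suc n)) λ x → Σ (Fin (suc n)) λ y → Σ (Fin (suc n) → Fin n) λ q →
    Dist2 G x y ×
    q x ≡ q y ×
    (∀ a b → q a ≡ q b → a ≡ b ⊎ (a ≡ x × b ≡ y) ⊎ (a ≡ y × b ≡ x)) ×
    Surjective _≡_ _≡_ q ×
    (∀ u v → (u ~[ H ] v → ∃ λ a → ∃ λ b → q a ≡ u × q b ≡ v × a ~[ G ] b)
           × ((∃ λ a → ∃ λ b → q a ≡ u × q b ≡ v × a ~[ G ] b) → u ~[ H ] v))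

data Folds : {n m : ℕ} → Graph n → Graph m → Set where
  done : ∀ {n} {G : Graph n} → Folds G G
  step : ∀ {n m} {G : Graph (suc n)} {H : Graph n} {K : Graph m} →
         SimpleFold G H → Folds H K → Folds G K

IsComplete : ∀ {s} → Graph s → Set
IsComplete K = ∀ i j → i ≢ j → i ~[ K ] j

FoldsOntoK : ∀ {n} → Graph n → ℕ → Set
FoldsOntoK G s = Σ (Graph s) λ K → IsComplete K × Folds G K

data Walk {n} (G : Graph n) : Fin n → Fin n → Set where
  here  : ∀ {i} → Walk G i i
  there : ∀ {i j k} → i ~[ G ] j → Walk G j k → Walk G i k

Connected : ∀ {n} → Graph n → Set
Connected G = ∀ i j → Walk G i j

induced : ∀ {n k} → (G : Graph n) → (Fin k → Fin n) → Graph k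
induced G e = record
  { Adj = λ i j → Adj G (e i) (e j)
  ; sym = λ i j → sym G (e i) (e j)
  ; irrefl = λ i → irrefl G (e i) }

-- e : Fin (suc k) → Fin n embeds a connected component of G:
-- injective, the induced subgraph is connected, and the image is closed
-- under adjacency (hence maximal)
IsComponent : ∀ {n k} → Graph n → (Fin (suc k) → Fin n) → Set
IsComponent {n} {k} G e =
  Injective _≡_ _≡_ e × Connected (induced G e) ×
  (∀ i (v : Fin n) → e i ~[ G ] v → ∃ λ j → e j ≡ v)

-- folding number: max over components C of max s with C folding onto K_s
IsFoldingNumber : ∀ {n} → Graph n → ℕ → Set
IsFoldingNumber {n} G s =
  (∃ λ k → Σ (Fin (suc k) → Fin n) λ e →
      IsComponent G e × FoldsOntoK (induced G e) s) ×
  (∀ k (e : Fin (suc k) → Fin n) → IsComponent G e →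
      ∀ t → FoldsOntoK (induced G e) t → t ≤ s)

-- The only property of threshold graphs used is that two distinct non-adjacent
-- vertices have nested neighbourhoods (forbidding an induced 2K₂ and P₄ suffices).
-- For such "nested" graphs we prove:
--   * Ψ ≤ χ: every colour class of a complete colouring has a vertex with the
--     largest neighbourhood in its class, and these dominant vertices form a clique,
--     which a proper colouring must colour injectively;
--   * Σ ≤ Ψ: a folding onto K_t is a homomorphism that is onto on vertices and on
--     edges, i.e. a complete t-colouring (of the folded component);
--   * a certificate: a proper k-colouring with a k-clique, together with a component
--     containing all edges that folds onto K_k.  It is built by induction on the
--     number of vertices: a complete graph is its own certificate; otherwise pick
--     non-adjacent x, y with N(y) ⊆ N(x), give y the colour of x, and either y is
--     isolated or folding y onto x reduces the component to that of G ∖ y.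
-- The certificate gives χ = k (colouring and clique), Ψ ≥ k (the colouring is complete
-- thanks to the clique) and Σ ≥ k (the folding), while Σ ≤ Ψ ≤ χ bound them above.
module Submission where

open import Defs
open import Data.Nat using (ℕ; zero; suc; _≤_; _≡ᵇ_)
open import Data.Bool using (Bool; true; false; _∧_; _∨_)
import Data.Bool.Properties as Bool
open import Data.Bool.Properties using (∧-comm; ∨-comm; not-¬; ¬-not)
open import Data.Fin using (Fin; zero; suc; toℕ; #_; punchIn; punchOut; _≟_)
open import Data.Fin.Properties
  using (punchInᵢ≢i; punchIn-injective; punchIn-punchOut; punchOut-punchIn; punchOut-cong; any?; injective⇒≤)
open import Data.List using (List; []; _∷_; allFin)
open import Data.List.Membership.Propositional using (_∈_)
open import Data.List.Membership.Propositional.Properties using (∈-allFin)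
import Data.List.Relation.Unary.Any as Any
open import Data.Product using (∃; ∃₂; _×_; _,_; proj₁; proj₂)
open import Data.Sum using (_⊎_; inj₁; inj₂; swap)
open import Data.Empty using (⊥-elim)
open import Relation.Nullary using (¬_; yes; no)
open import Relation.Nullary.Decidable using (¬?; _×-dec_)
open import Relation.Unary using (Decidable)
open import Relation.Binary.Definitions using (Reflexive; Transitive)
open import Relation.Binary.PropositionalEquality
  using (_≡_; _≢_; refl; trans; cong; cong₂; ≢-sym) renaming (sym to ≡-sym)
open import Function using (_∘_; id)
open import Function.Definitions using (Injective; Surjective)

private variable n m k : ℕ

~-sym : (G : Graph n) {u v : Fin n} → u ~[ G ] v → v ~[ G ] u
~-sym G {u} {v} u~v = trans (sym G v u) u~v

~⇒≢ : (G : Graph n) {u v : Fin n} → u ~[ G ] v → u ≢ v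
~⇒≢ G {u} u~u refl = not-¬ u~u (irrefl G u)

separated⇒≢ : (G : Graph n) {w u v : Fin n} → w ~[ G ] u → Adj G w v ≡ false → u ≢ v
separated⇒≢ G w~u w≁v refl = not-¬ w~u w≁v

_⊑[_]_ : Fin n → Graph n → Fin n → Set
u ⊑[ G ] v = ∀ w → u ~[ G ] w → v ~[ G ] w

included? : (f g : Fin n → Bool) →
  (∀ w → f w ≡ true → g w ≡ true) ⊎ ∃ λ w → f w ≡ true × g w ≡ false
included? f g with any? (λ w → (f w Bool.≟ true) ×-dec (g w Bool.≟ false))
... | yes (w , fw , ¬gw) = inj₂ (w , fw , ¬gw)
... | no none = inj₁ λ w fw → ¬-not λ ¬gw → none (w , fw , ¬gw)

complete-or-nonadjacent : (G : Graph n) →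
  IsComplete G ⊎ ∃₂ λ x y → x ≢ y × Adj G x y ≡ false
complete-or-nonadjacent G
  with any? (λ x → any? (λ y → ¬? (x ≟ y) ×-dec (Adj G x y Bool.≟ false)))
... | yes (x , y , x≢y , x≁y) = inj₂ (x , y , x≢y , x≁y)
... | no none = inj₁ λ x y x≢y → ¬-not λ x≁y → none (x , y , x≢y , x≁y)

quad : Fin n → Fin n → Fin n → Fin n → Fin 4 → Fin n
quad a b c d zero = a
quad a b c d (suc zero) = b
quad a b c d (suc (suc zero)) = c
quad a b c d (suc (suc (suc zero))) = d

swap-orientations : ∀ p q r s → (p ∧ q) ∨ (r ∧ s) ≡ (s ∧ r) ∨ (q ∧ p)
swap-orientations p q r s = trans (∨-comm (p ∧ q) (r ∧ s)) (cong₂ _∨_ (∧-comm r s) (∧-comm p q))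

fromEdges-sym : ∀ es (i j : Fin 4) → fromEdges es i j ≡ fromEdges es j i
fromEdges-sym [] i j = refl
fromEdges-sym ((a , b) ∷ es) i j =
  cong₂ _∨_ (swap-orientations (toℕ i ≡ᵇ a) (toℕ j ≡ᵇ b) (toℕ i ≡ᵇ b) (toℕ j ≡ᵇ a))
            (fromEdges-sym es i j)

Realises : Graph n → (Fin 4 → Fin 4 → Bool) → (Fin 4 → Fin n) → Fin 4 → Fin 4 → Set
Realises G H f i j = f i ≢ f j × Adj G (f i) (f j) ≡ H i j

fin4-pairs : (P : Fin 4 → Fin 4 → Set) → (∀ {i j} → P i j → P j i) →
  P (# 0) (# 1) → P (# 0) (# 2) → P (# 0) (# 3) →
  P (# 1) (# 2) → P (# 1) (# 3) → P (# 2) (# 3) →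
  ∀ i j → i ≢ j → P i j
fin4-pairs P flip p01 p02 p03 p12 p13 p23 = pair
  where
  pair : ∀ i j → i ≢ j → P i j
  pair zero zero i≢i = ⊥-elim (i≢i refl)
  pair zero (suc zero) _ = p01
  pair zero (suc (suc zero)) _ = p02
  pair zero (suc (suc (suc zero))) _ = p03
  pair (suc zero) zero _ = flip p01
  pair (suc zero) (suc zero) i≢i = ⊥-elim (i≢i refl)
  pair (suc zero) (suc (suc zero)) _ = p12
  pair (suc zero) (suc (suc (suc zero))) _ = p13
  pair (suc (suc zero)) zero _ = flip p02
  pair (suc (suc zero)) (suc zero) _ = flip p12
  pair (suc (suc zero)) (suc (suc zero)) i≢i = ⊥-elim (i≢i refl)
  pair (suc (suc zero)) (suc (suc (suc zero))) _ = p23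
  pair (suc (suc (suc zero))) zero _ = flip p03
  pair (suc (suc (suc zero))) (suc zero) _ = flip p13
  pair (suc (suc (suc zero))) (suc (suc zero)) _ = flip p23
  pair (suc (suc (suc zero))) (suc (suc (suc zero))) i≢i = ⊥-elim (i≢i refl)

2K₂-sym : ∀ i j → 2K₂ i j ≡ 2K₂ j i
2K₂-sym = fromEdges-sym ((0 , 1) ∷ (2 , 3) ∷ [])

P₄-sym : ∀ i j → P₄ i j ≡ P₄ j i
P₄-sym = fromEdges-sym ((0 , 1) ∷ (1 , 2) ∷ (2 , 3) ∷ [])

inducedCopy : (G : Graph n) (H : Fin 4 → Fin 4 → Bool) → (∀ i j → H i j ≡ H j i) →
  (a b c d : Fin n) → let P = Realises G H (quad a b c d) in
  P (# 0) (# 1) → P (# 0) (# 2) → P (# 0) (# 3) →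
  P (# 1) (# 2) → P (# 1) (# 3) → P (# 2) (# 3) → HasInduced G H
inducedCopy G H H-sym a b c d p01 p02 p03 p12 p13 p23 =
  f , injective , λ i j i≢j → proj₂ (realised i j i≢j)
  where
  f = quad a b c d
  flip : ∀ {i j} → Realises G H f i j → Realises G H f j i
  flip {i} {j} (fi≢fj , adj) = ≢-sym fi≢fj , trans (sym G (f j) (f i)) (trans adj (H-sym i j))
  realised : ∀ i j → i ≢ j → Realises G H f i j
  realised = fin4-pairs (Realises G H f) flip p01 p02 p03 p12 p13 p23
  injective : Injective _≡_ _≡_ f
  injective {i} {j} fi≡fj with i ≟ j
  ... | yes i≡j = i≡j
  ... | no i≢j = ⊥-elim (proj₁ (realised i j i≢j) fi≡fj)

NestedNeighbourhoods : Graph n → Set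
NestedNeighbourhoods G = ∀ x y → x ≢ y → Adj G x y ≡ false → y ⊑[ G ] x ⊎ x ⊑[ G ] y

-- For non-adjacent x, y, vertices a ∈ N(y) ∖ N(x) and b ∈ N(x) ∖ N(y) span an
-- induced 2K₂ (edges xb, ya) if a ≁ b, and an induced P₄ (path x b a y) if a ~ b.
crossing⇒2K₂-or-P₄ : (G : Graph n) {x y a b : Fin n} → x ≢ y → Adj G x y ≡ false →
  y ~[ G ] a → Adj G x a ≡ false → x ~[ G ] b → Adj G y b ≡ false →
  HasInduced G 2K₂ ⊎ HasInduced G P₄
crossing⇒2K₂-or-P₄ G {x} {y} {a} {b} x≢y x≁y y~a x≁a x~b y≁b = byEdge (Adj G b a) refl
  where
  x≢b = ~⇒≢ G x~b
  x≢a = ≢-sym (separated⇒≢ G y~a (trans (sym G y x) x≁y))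
  b≢y = separated⇒≢ G x~b x≁y
  b≢a = separated⇒≢ G x~b x≁a
  y≢a = ~⇒≢ G y~a
  b≁y = trans (sym G b y) y≁b
  byEdge : (t : Bool) → Adj G b a ≡ t → HasInduced G 2K₂ ⊎ HasInduced G P₄
  byEdge false b≁a = inj₁ (inducedCopy G 2K₂ 2K₂-sym x b y a
    (x≢b , x~b) (x≢y , x≁y) (x≢a , x≁a) (b≢y , b≁y) (b≢a , b≁a) (y≢a , y~a))
  byEdge true b~a = inj₂ (inducedCopy G P₄ P₄-sym x b a y
    (x≢b , x~b) (x≢a , x≁a) (x≢y , x≁y) (b≢a , b~a) (b≢y , b≁y) (≢-sym y≢a , ~-sym G y~a))

threshold⇒nested : (G : Graph n) → Threshold G → NestedNeighbourhoods G
threshold⇒nested G (no2K₂ , _ , noP₄) x y x≢y x≁y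
  with included? (Adj G y) (Adj G x) | included? (Adj G x) (Adj G y)
... | inj₁ y⊑x | _ = inj₁ y⊑x
... | inj₂ _ | inj₁ x⊑y = inj₂ x⊑y
... | inj₂ (a , y~a , x≁a) | inj₂ (b , x~b , y≁b)
  with crossing⇒2K₂-or-P₄ G x≢y x≁y y~a x≁a x~b y≁b
... | inj₁ induced2K₂ = ⊥-elim (no2K₂ induced2K₂)
... | inj₂ inducedP₄ = ⊥-elim (noP₄ inducedP₄)

nested-induced : (G : Graph n) → NestedNeighbourhoods G →
  (f : Fin m → Fin n) → Injective _≡_ _≡_ f → NestedNeighbourhoods (induced G f)
nested-induced G nested f f-injective x y x≢y x≁y with nested (f x) (f y) (x≢y ∘ f-injective) x≁y
... | inj₁ y⊑x = inj₁ (λ w → y⊑x (f w))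
... | inj₂ x⊑y = inj₂ (λ w → x⊑y (f w))

-- Ψ ≤ χ for nested graphs

greatest : ∀ {N} (P : Fin N → Set) → Decidable P →
  (R : Fin N → Fin N → Set) → Reflexive R → Transitive R →
  (∀ u v → P u → P v → R u v ⊎ R v u) →
  ∃ P → ∃ λ b → P b × ∀ u → P u → R u b
greatest {N} P P? R R-refl R-trans R-total (b₀ , Pb₀) =
  let b , Pb , above = greatestIn (allFin N) in b , Pb , λ u → above u (∈-allFin u)
  where
  greatestIn : (L : List (Fin N)) → ∃ λ b → P b × ∀ u → u ∈ L → P u → R u b
  greatestIn [] = b₀ , Pb₀ , λ _ ()
  greatestIn (u ∷ L) with greatestIn L | P? u
  ... | b , Pb , above | no ¬Pu =
    b , Pb , λ { _ (Any.here refl) Pu → ⊥-elim (¬Pu Pu) ; w (Any.there w∈L) → above w w∈L }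
  ... | b , Pb , above | yes Pu with R-total u b Pu Pb
  ...   | inj₁ u≤b = b , Pb , λ { _ (Any.here refl) _ → u≤b ; w (Any.there w∈L) → above w w∈L }
  ...   | inj₂ b≤u = u , Pu , λ { _ (Any.here refl) _ → R-refl
                                ; w (Any.there w∈L) Pw → R-trans (above w w∈L Pw) b≤u }

-- A proper k-colouring is injective on a clique, so a clique of size m forces m ≤ k.
clique≤colours : (G : Graph n) (c : Fin n → Fin k) → ProperColoring G k c →
  (q : Fin m → Fin n) → (∀ i j → i ≢ j → q i ~[ G ] q j) → m ≤ k
clique≤colours G c proper q clique = injective⇒≤ {f = c ∘ q} injective
  where
  injective : Injective _≡_ _≡_ (c ∘ q)
  injective {i} {j} cqi≡cqj with i ≟ j
  ... | yes i≡j = i≡j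
  ... | no i≢j = ⊥-elim (proper (q i) (q j) (clique i j i≢j) cqi≡cqj)

-- In a nested graph every colour class of a complete colouring d has a dominant
-- vertex (its neighbourhood contains those of the whole class).  For colours α ≠ β
-- some edge i j joins the classes, so j ∈ N(i) ⊆ N(dom α) and dom α ∈ N(j) ⊆ N(dom β):
-- the dominant vertices form an m-clique, whence m ≤ k for any proper k-colouring.
complete≤proper : (G : Graph n) → NestedNeighbourhoods G →
  (c : Fin n → Fin k) → ProperColoring G k c →
  (d : Fin n → Fin m) → CompleteColoring G m d → m ≤ k
complete≤proper {n = n} {m = m} G nested c c-proper d (d-proper , d-onto , d-complete) =
  clique≤colours G c c-proper dominant dominant-clique
  where
  comparable : ∀ α u v → d u ≡ α → d v ≡ α → u ⊑[ G ] v ⊎ v ⊑[ G ] u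
  comparable α u v du dv with u ≟ v
  ... | yes refl = inj₁ (λ _ u~w → u~w)
  ... | no u≢v with Adj G u v in u?v
  ...   | true = ⊥-elim (d-proper u v u?v (trans du (≡-sym dv)))
  ...   | false = swap (nested u v u≢v u?v)
  dominantOf : (α : Fin m) → ∃ λ b → d b ≡ α × ∀ u → d u ≡ α → u ⊑[ G ] b
  dominantOf α = greatest (λ u → d u ≡ α) (λ u → d u ≟ α) _⊑[ G ]_
    (λ _ u~w → u~w) (λ u⊑v v⊑w w u~w → v⊑w w (u⊑v w u~w)) (λ u v → comparable α u v)
    (proj₁ (d-onto α) , proj₂ (d-onto α) refl)
  dominant : Fin m → Fin n
  dominant α = proj₁ (dominantOf α)
  dominates : ∀ α u → d u ≡ α → u ⊑[ G ] dominant α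
  dominates α = proj₂ (proj₂ (dominantOf α))
  dominant-clique : ∀ α β → α ≢ β → dominant α ~[ G ] dominant β
  dominant-clique α β α≢β with d-complete α β α≢β
  ... | i , j , i~j , di , dj =
    ~-sym G (dominates β j dj (dominant α) (~-sym G (dominates α i di j i~j)))

-- Σ ≤ Ψ: foldings are complete colourings

-- what a folding G ⇝ K provides: a homomorphism onto K's vertices and onto its edges
record FoldingMap (G : Graph n) (K : Graph m) : Set where
  field
    φ            : Fin n → Fin m
    homomorphism : ∀ a b → a ~[ G ] b → φ a ~[ K ] φ b
    edge-onto    : ∀ u v → u ~[ K ] v → ∃₂ λ a b → φ a ≡ u × φ b ≡ v × a ~[ G ] b
    vertex-onto  : ∀ u → ∃ λ a → φ a ≡ u

identityMap : (G : Graph n) → FoldingMap G G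
identityMap G = record
  { φ = id ; homomorphism = λ _ _ a~b → a~b
  ; edge-onto = λ u v u~v → u , v , refl , refl , u~v ; vertex-onto = λ u → u , refl }

simpleFold∘ : {G : Graph (suc n)} {H : Graph n} {K : Graph m} →
  SimpleFold G H → FoldingMap H K → FoldingMap G K
simpleFold∘ {G = G} {H} {K} (x , y , q , _ , _ , _ , q-onto , edges) F = record
  { φ = F.φ ∘ q ; homomorphism = homomorphism ; edge-onto = edge-onto ; vertex-onto = vertex-onto }
  where
  module F = FoldingMap F
  homomorphism : ∀ a b → a ~[ G ] b → F.φ (q a) ~[ K ] F.φ (q b)
  homomorphism a b a~b = F.homomorphism (q a) (q b) (proj₂ (edges (q a) (q b)) (a , b , refl , refl , a~b))
  edge-onto : ∀ u v → u ~[ K ] v → ∃₂ λ a b → F.φ (q a) ≡ u × F.φ (q b) ≡ v × a ~[ G ] b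
  edge-onto u v u~v with F.edge-onto u v u~v
  ... | a′ , b′ , φa′ , φb′ , a′~b′ with proj₁ (edges a′ b′) a′~b′
  ... | a , b , qa , qb , a~b = a , b , trans (cong F.φ qa) φa′ , trans (cong F.φ qb) φb′ , a~b
  vertex-onto : ∀ u → ∃ λ a → F.φ (q a) ≡ u
  vertex-onto u with F.vertex-onto u
  ... | a′ , φa′ with q-onto a′
  ... | a , qa = a , trans (cong F.φ (qa refl)) φa′

foldingMap : {G : Graph n} {K : Graph m} → Folds G K → FoldingMap G K
foldingMap {G = G} done = identityMap G
foldingMap (step fold rest) = simpleFold∘ fold (foldingMap rest)

folding⇒complete : {G : Graph n} {K : Graph m} → IsComplete K →
  (F : FoldingMap G K) → CompleteColoring G m (FoldingMap.φ F)
folding⇒complete {G = G} {K} K-complete F = proper , onto , complete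
  where
  open FoldingMap F
  proper : ProperColoring G _ φ
  proper a b a~b φa≡φb = ~⇒≢ K (homomorphism a b a~b) φa≡φb
  onto : ∀ u → ∃ λ a → ∀ {z} → z ≡ a → φ z ≡ u
  onto u with vertex-onto u
  ... | a , φa = a , λ { refl → φa }
  complete : ∀ α β → α ≢ β → ∃₂ λ i j → i ~[ G ] j × φ i ≡ α × φ j ≡ β
  complete α β α≢β with edge-onto α β (K-complete α β α≢β)
  ... | a , b , φa , φb , a~b = a , b , a~b , φa , φb

record CliqueColouring (G : Graph n) (k : ℕ) : Set where
  field
    colour          : Fin n → Fin k
    proper          : ProperColoring G k colour
    clique          : Fin k → Fin n
    clique-adjacent : ∀ i j → i ≢ j → clique i ~[ G ] clique j
    clique-colour   : ∀ i → colour (clique i) ≡ i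

-- a connected induced subgraph containing every non-isolated vertex (hence a
-- connected component) which folds onto K_k
record FoldingComponent (G : Graph n) (k : ℕ) : Set where
  field
    size      : ℕ
    embed     : Fin (suc size) → Fin n
    injective : Injective _≡_ _≡_ embed
    connected : Connected (induced G embed)
    covers    : ∀ v w → v ~[ G ] w → ∃ λ j → embed j ≡ v
    folds     : FoldsOntoK (induced G embed) k

Certificate : Graph n → ℕ → Set
Certificate G k = CliqueColouring G k × FoldingComponent G k

-- the colouring gives χ ≤ k and the clique χ ≥ k
chromatic : (G : Graph n) → CliqueColouring G k → IsChromaticNumber G k
chromatic G C = (colour , proper) , λ m c c-proper → clique≤colours G c c-proper clique clique-adjacent
  where open CliqueColouring C

-- the clique makes the colouring complete, and Ψ ≤ χ bounds every complete colouring
achromatic : (G : Graph n) → NestedNeighbourhoods G → CliqueColouring G k → IsAchromaticNumber G k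
achromatic G nested C =
  (colour , proper , onto , complete) , λ m d d-complete → complete≤proper G nested colour proper d d-complete
  where
  open CliqueColouring C
  onto : ∀ α → ∃ λ v → ∀ {u} → u ≡ v → colour u ≡ α
  onto α = clique α , λ { refl → clique-colour α }
  complete : ∀ α β → α ≢ β → ∃₂ λ u v → u ~[ G ] v × colour u ≡ α × colour v ≡ β
  complete α β α≢β = clique α , clique β , clique-adjacent α β α≢β , clique-colour α , clique-colour β

-- The folding component gives Σ ≥ k.  Conversely a folding of any component onto
-- K_t is a complete t-colouring of that (nested) component, which the colouring of G
-- properly k-colours, so t ≤ k by Ψ ≤ χ.
folding : (G : Graph n) → NestedNeighbourhoods G →
  CliqueColouring G k → FoldingComponent G k → IsFoldingNumber G k
folding {n = n} {k = k} G nested C F = (size , embed , (injective , connected , closed) , folds) , bound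
  where
  open CliqueColouring C
  open FoldingComponent F
  closed : ∀ i v → embed i ~[ G ] v → ∃ λ j → embed j ≡ v
  closed i v ei~v = covers v (embed i) (~-sym G ei~v)
  bound : ∀ s (e : Fin (suc s) → Fin n) → IsComponent G e →
    ∀ t → FoldsOntoK (induced G e) t → t ≤ k
  bound s e (e-injective , _ , _) t (K , K-complete , G⇝K) =
    complete≤proper (induced G e) (nested-induced G nested e e-injective)
      (colour ∘ e) (λ a b → proper (e a) (e b)) _ (folding⇒complete K-complete (foldingMap G⇝K))

_∖_ : Graph (suc n) → Fin (suc n) → Graph n
G ∖ y = induced G (punchIn y)

deleted-or-kept : (y v : Fin (suc n)) → v ≡ y ⊎ ∃ λ v′ → punchIn y v′ ≡ v
deleted-or-kept y v with v ≟ y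
... | yes v≡y = inj₁ v≡y
... | no v≢y = inj₂ (punchOut (v≢y ∘ ≡-sym) , punchIn-punchOut (v≢y ∘ ≡-sym))

extendAt : (y : Fin (suc n)) → (Fin n → Fin k) → Fin k → Fin (suc n) → Fin k
extendAt y c cy v with v ≟ y
... | yes _ = cy
... | no v≢y = c (punchOut (v≢y ∘ ≡-sym))

extendAt-deleted : (y : Fin (suc n)) (c : Fin n → Fin k) (cy : Fin k) → extendAt y c cy y ≡ cy
extendAt-deleted y c cy with y ≟ y
... | yes _ = refl
... | no y≢y = ⊥-elim (y≢y refl)

extendAt-kept : (y : Fin (suc n)) (c : Fin n → Fin k) (cy : Fin k) (v : Fin n) →
  extendAt y c cy (punchIn y v) ≡ c v
extendAt-kept y c cy v with punchIn y v ≟ y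
... | yes v≡y = ⊥-elim (punchInᵢ≢i y v v≡y)
... | no v≢y = cong c (trans (punchOut-cong y refl) (punchOut-punchIn y))

extendAt-proper : (G : Graph (suc n)) (y : Fin (suc n)) (c : Fin n → Fin k) (cy : Fin k) →
  ProperColoring (G ∖ y) k c → (∀ b → y ~[ G ] punchIn y b → c b ≢ cy) →
  ProperColoring G k (extendAt y c cy)
extendAt-proper G y c cy c-proper cy-avoids a b a~b with deleted-or-kept y a | deleted-or-kept y b
... | inj₁ refl | inj₁ refl = ⊥-elim (~⇒≢ G a~b refl)
... | inj₁ refl | inj₂ (b′ , refl) = λ ca≡cb →
  cy-avoids b′ a~b (trans (≡-sym (extendAt-kept y c cy b′)) (trans (≡-sym ca≡cb) (extendAt-deleted y c cy)))
... | inj₂ (a′ , refl) | inj₁ refl = λ ca≡cb →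
  cy-avoids a′ (~-sym G a~b) (trans (≡-sym (extendAt-kept y c cy a′)) (trans ca≡cb (extendAt-deleted y c cy)))
... | inj₂ (a′ , refl) | inj₂ (b′ , refl) = λ ca≡cb →
  c-proper a′ b′ a~b (trans (≡-sym (extendAt-kept y c cy a′)) (trans ca≡cb (extendAt-kept y c cy b′)))

extendCliqueColouring : (G : Graph (suc n)) (y : Fin (suc n)) (x : Fin n) →
  y ⊑[ G ] punchIn y x → CliqueColouring (G ∖ y) k → CliqueColouring G k
extendCliqueColouring G y x y⊑x C = record
  { colour = extendAt y colour (colour x)
  ; proper = extendAt-proper G y colour (colour x) proper
      (λ b y~b cb≡cx → proper x b (y⊑x _ y~b) (≡-sym cb≡cx))
  ; clique = punchIn y ∘ clique
  ; clique-adjacent = clique-adjacent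
  ; clique-colour = λ i → trans (extendAt-kept y colour (colour x) (clique i)) (clique-colour i)
  }
  where open CliqueColouring C

completeCertificate : (G : Graph (suc n)) → IsComplete G → Certificate G (suc n)
completeCertificate {n = n} G complete = colouring , component
  where
  colouring : CliqueColouring G (suc n)
  colouring = record
    { colour = id ; proper = λ a b a~b → ~⇒≢ G a~b ; clique = id
    ; clique-adjacent = complete ; clique-colour = λ _ → refl }
  connected : Connected (induced G id)
  connected i j with i ≟ j
  ... | yes refl = here
  ... | no i≢j = there (complete i j i≢j) here
  component : FoldingComponent G (suc n)
  component = record
    { size = n ; embed = id ; injective = id ; connected = connected
    ; covers = λ v _ _ → v , refl ; folds = induced G id , complete , done }

isolatedVertex : (G : Graph (suc n)) (y : Fin (suc n)) → (∀ w → ¬ y ~[ G ] w) →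
  FoldingComponent (G ∖ y) k → FoldingComponent G k
isolatedVertex G y isolated F = record
  { size = size ; embed = punchIn y ∘ embed
  ; injective = λ p → injective (punchIn-injective y _ _ p)
  ; connected = connected ; covers = covers′ ; folds = folds }
  where
  open FoldingComponent F
  covers′ : ∀ v w → v ~[ G ] w → ∃ λ j → punchIn y (embed j) ≡ v
  covers′ v w v~w with deleted-or-kept y v | deleted-or-kept y w
  ... | inj₁ refl | _ = ⊥-elim (isolated w v~w)
  ... | inj₂ _ | inj₁ refl = ⊥-elim (isolated v (~-sym G v~w))
  ... | inj₂ (v′ , refl) | inj₂ (w′ , refl) =
    let j , ej = covers v′ w′ v~w in j , cong (punchIn y) ej

walk-snoc : {G : Graph n} {i j l : Fin n} → Walk G i j → j ~[ G ] l → Walk G i l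
walk-snoc here j~l = there j~l here
walk-snoc (there i~i′ w) j~l = there i~i′ (walk-snoc w j~l)

walk-reverse : {G : Graph n} {i j : Fin n} → Walk G i j → Walk G j i
walk-reverse here = here
walk-reverse {G = G} (there i~i′ w) = walk-snoc (walk-reverse w) (~-sym G i~i′)

-- the embedding of y followed by a subgraph e of G ∖ y; index 0 is y
insert : ∀ {s} (y : Fin (suc n)) → (Fin s → Fin n) → Fin (suc s) → Fin (suc n)
insert y e zero = y
insert y e (suc i) = punchIn y (e i)

insert-injective : ∀ {s} (y : Fin (suc n)) (e : Fin s → Fin n) →
  Injective _≡_ _≡_ e → Injective _≡_ _≡_ (insert y e)
insert-injective y e e-injective {zero} {zero} _ = refl
insert-injective y e e-injective {zero} {suc j} y≡ej = ⊥-elim (punchInᵢ≢i y _ (≡-sym y≡ej))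
insert-injective y e e-injective {suc i} {zero} ei≡y = ⊥-elim (punchInᵢ≢i y _ ei≡y)
insert-injective y e e-injective {suc i} {suc j} ei≡ej =
  cong suc (e-injective (punchIn-injective y _ _ ei≡ej))

insert-connected : ∀ {s} (G : Graph (suc n)) (y : Fin (suc n)) (e : Fin s → Fin n) →
  Connected (induced (G ∖ y) e) → (j : Fin s) → y ~[ G ] punchIn y (e j) →
  Connected (induced G (insert y e))
insert-connected G y e connected j y~ej = walk
  where
  lift : ∀ {a b} → Walk (induced (G ∖ y) e) a b → Walk (induced G (insert y e)) (suc a) (suc b)
  lift here = here
  lift (there a~a′ w) = there a~a′ (lift w)
  walk : Connected (induced G (insert y e))
  walk zero zero = here
  walk zero (suc b) = there y~ej (lift (connected j b))
  walk (suc a) zero = walk-reverse (there y~ej (lift (connected j a)))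
  walk (suc a) (suc b) = lift (connected a b)

-- if e covers the non-isolated vertices of G ∖ y and N(y) ⊆ N(x), then insert y e
-- covers those of G: a neighbour of y is a neighbour of x
insert-covers : ∀ {s} (G : Graph (suc n)) (y : Fin (suc n)) (e : Fin s → Fin n) →
  (∀ v w → v ~[ G ∖ y ] w → ∃ λ j → e j ≡ v) →
  (x : Fin n) → y ⊑[ G ] punchIn y x →
  ∀ v w → v ~[ G ] w → ∃ λ j → insert y e j ≡ v
insert-covers G y e covers x y⊑x v w v~w with deleted-or-kept y v
... | inj₁ refl = zero , refl
... | inj₂ (v′ , refl) with deleted-or-kept y w
...   | inj₁ refl =
  let j , ej = covers v′ x (~-sym G (y⊑x _ (~-sym G v~w))) in suc j , cong (punchIn y) ej
...   | inj₂ (w′ , refl) = let j , ej = covers v′ w′ v~w in suc j , cong (punchIn y) ej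

collapse : ∀ {s} → Fin s → Fin (suc s) → Fin s
collapse x zero = x
collapse x (suc i) = i

collapse-fibres : ∀ {s} (x : Fin s) a b → collapse x a ≡ collapse x b →
  a ≡ b ⊎ (a ≡ suc x × b ≡ zero) ⊎ (a ≡ zero × b ≡ suc x)
collapse-fibres x zero zero _ = inj₁ refl
collapse-fibres x zero (suc b) x≡b = inj₂ (inj₂ (refl , cong suc (≡-sym x≡b)))
collapse-fibres x (suc a) zero a≡x = inj₂ (inj₁ (cong suc a≡x , refl))
collapse-fibres x (suc a) (suc b) a≡b = inj₁ (cong suc a≡b)

-- If N(y) ⊆ N(x) for x = e x̂ and y has a neighbour e ŵ, then y and x are at distance
-- two in the subgraph on y and e, and identifying them is a simple fold onto the
-- subgraph on e: every edge at y is also an edge at x.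
foldOnto : ∀ {s} (G : Graph (suc n)) (y : Fin (suc n)) (e : Fin s → Fin n) (x̂ ŵ : Fin s) →
  y ⊑[ G ] punchIn y (e x̂) → y ~[ G ] punchIn y (e ŵ) →
  SimpleFold (induced G (insert y e)) (induced (G ∖ y) e)
foldOnto G y e x̂ ŵ y⊑x y~w =
  suc x̂ , zero , collapse x̂ , distance-two , refl , collapse-fibres x̂ , onto , edges
  where
  x = punchIn y (e x̂)
  distance-two : Dist2 (induced G (insert y e)) (suc x̂) zero
  distance-two = (λ ()) , ¬-not (λ x~y → ~⇒≢ G (y⊑x x (~-sym G x~y)) refl)
               , suc ŵ , y⊑x _ y~w , ~-sym G y~w
  onto : Surjective _≡_ _≡_ (collapse x̂)
  onto u = suc u , λ { refl → refl }
  collapse-edge : ∀ a b → insert y e a ~[ G ] insert y e b →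
    punchIn y (e (collapse x̂ a)) ~[ G ] punchIn y (e (collapse x̂ b))
  collapse-edge zero zero y~y = ⊥-elim (~⇒≢ G y~y refl)
  collapse-edge zero (suc b) y~b = y⊑x _ y~b
  collapse-edge (suc a) zero a~y = ~-sym G (y⊑x _ (~-sym G a~y))
  collapse-edge (suc a) (suc b) a~b = a~b
  edges : ∀ u v → (u ~[ induced (G ∖ y) e ] v →
                    ∃₂ λ a b → collapse x̂ a ≡ u × collapse x̂ b ≡ v × a ~[ induced G (insert y e) ] b)
                × ((∃₂ λ a b → collapse x̂ a ≡ u × collapse x̂ b ≡ v × a ~[ induced G (insert y e) ] b) →
                    u ~[ induced (G ∖ y) e ] v)
  edges u v = (λ u~v → suc u , suc v , refl , refl , u~v)
            , λ { (a , b , refl , refl , a~b) → collapse-edge a b a~b }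

-- If N(y) ⊆ N(x) and y has a neighbour w, the component of G is y together with that
-- of G ∖ y, and it folds (y onto x) onto it, hence onto the same complete graph.
foldVertex : (G : Graph (suc n)) (y : Fin (suc n)) (x w : Fin n) →
  y ⊑[ G ] punchIn y x → y ~[ G ] punchIn y w →
  FoldingComponent (G ∖ y) k → FoldingComponent G k
foldVertex G y x w y⊑x y~w F
  with FoldingComponent.covers F x w (y⊑x _ y~w)
     | FoldingComponent.covers F w x (~-sym G (y⊑x _ y~w))
... | x̂ , refl | ŵ , refl = record
  { size = suc size ; embed = insert y embed
  ; injective = insert-injective y embed injective
  ; connected = insert-connected G y embed connected ŵ y~w
  ; covers = insert-covers G y embed covers (embed x̂) y⊑x
  ; folds = let K , K-complete , H⇝K = folds
            in K , K-complete , step (foldOnto G y embed x̂ ŵ y⊑x y~w) H⇝K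
  }
  where open FoldingComponent F

-- Removing a vertex y with N(y) ⊆ N(x), x ≠ y: y takes the colour of x, and either
-- y is isolated or folding y onto x reduces the component to that of G ∖ y.
dominatedStep : (G : Graph (suc (suc n))) (x y : Fin (suc (suc n))) → x ≢ y → y ⊑[ G ] x →
  ∃ (Certificate (G ∖ y)) → ∃ (Certificate G)
dominatedStep G x y x≢y y⊑x (k , C , F) with deleted-or-kept y x
... | inj₁ x≡y = ⊥-elim (x≢y x≡y)
... | inj₂ (x′ , refl) = k , extendCliqueColouring G y x′ y⊑x C , component
  where
  component : FoldingComponent G k
  component with any? (λ w → Adj G y w Bool.≟ true)
  ... | no isolated = isolatedVertex G y (λ w y~w → isolated (w , y~w)) F
  ... | yes (w , y~w) with deleted-or-kept y w
  ...   | inj₁ refl = ⊥-elim (~⇒≢ G y~w refl)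
  ...   | inj₂ (w′ , refl) = foldVertex G y x′ w′ y⊑x y~w F

certificate : ∀ n (G : Graph (suc n)) → NestedNeighbourhoods G → ∃ (Certificate G)
certificate n G nested with complete-or-nonadjacent G
... | inj₁ complete = suc n , completeCertificate G complete
certificate zero G nested | inj₂ (zero , zero , 0≢0 , _) = ⊥-elim (0≢0 refl)
certificate (suc n) G nested | inj₂ (x , y , x≢y , x≁y) with nested x y x≢y x≁y
... | inj₁ y⊑x = dominatedStep G x y x≢y y⊑x
  (certificate n (G ∖ y) (nested-induced G nested (punchIn y) (punchIn-injective y _ _)))
... | inj₂ x⊑y = dominatedStep G y x (≢-sym x≢y) x⊑y
  (certificate n (G ∖ x) (nested-induced G nested (punchIn x) (punchIn-injective x _ _)))

mainTheorem12 : ∀ n (G : Graph (suc n)) → Threshold G →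
    ∃ λ k → IsChromaticNumber G k × IsFoldingNumber G k × IsAchromaticNumber G k
mainTheorem12 n G threshold =
  let nested = threshold⇒nested G threshold
      k , colouring , component = certificate n G nested
  in k , chromatic G colouring , folding G nested colouring component , achromatic G nested colouring
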